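{- Let $\Gamma=(U\cup V,E)$ be a $3$-regular bipartite graph with bipartition $U,V$, let $\hat\Gamma$ be its CFI graph with sides $X,Y$, $n=|X|=|Y|$, and fix bijections $\eta:X\to[n]$, $\eta':Y\to[n]$. For any $2$-factor $F$ of $\Gamma$, any function $f:F\to\{0,1\}$ and any perfect matchings $\mu_1,\mu_2\in\mu(F,f)$, we have $\mathrm{sgn}(\mu_1)=\mathrm{sgn}(\mu_2)$.
   Context: CFI graph $\hat\Gamma$: for each vertex $v$ of $\Gamma$ with neighbour set $N(v)$ (of size 3), introduce a set $I_v$ of four inner vertices $v_S$, one for each $S\subseteq N(v)$ of even size, and a set $O_v$ of six outer vertices $(v,u,0),(v,u,1)$ for $u\in N(v)$; add an edge between $v_S$ and $(v,u,1)$ if $u\in S$ and between $v_S$ and $(v,u,0)$ if $u\notin S$. For each edge $e=\{u,v\}\in E$ add two edges: $e_0$ joining $(v,u,0)$ and $(u,v,0)$, and $e_1$ joining $(v,u,1)$ and $(u,v,1)$. Let $X=\bigcup_{v\in U} I_v\cup\bigcup_{v\in V}O_v$ and $Y=\bigcup_{v\in V}I_v\cup\bigcup_{v\in U}O_v$; every edge of $\hat\Gamma$ joins $X$ and $Y$, and $|X|=|Y|$. A perfect matching is identified with a bijection $\mu:X\to Y$ with $\mu(x)$ adjacent to $x$; $\mathrm{sgn}(\mu)$ is the sign of the permutation $\eta'\circ\mu\circ\eta^{ -1}$ of $[n]$. A $2$-factor of $\Gamma$ is a set $F\subseteq E$ with every vertex incident to exactly two edges of $F$. A perfect matching is uniform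 if for every $e\in E$ at most one of $e_0,e_1$ belongs to it. $\mu(F,f)$ is the set of uniform perfect matchings $\mu$ with $\{e\in E:\text{exactly one of } e_0,e_1\in\mu\}=F$ and $e_{f(e)}\in\mu$ for every $e\in F$. -}

module Defs where

open import Data.Bool using (Bool; true; false; T; not; _∨_; _∧_; if_then_else_)
open import Data.Nat using (ℕ; zero; suc; _%_; _≡ᵇ_; _<ᵇ_)
open import Data.Fin using (Fin; toℕ)
open import Data.Fin.Subset using (Subset; ∣_∣)
open import Data.Vec using (tabulate; lookup)
open import Data.List using (List; allFin; map; foldr)
open import Data.Nat.ListAction using (sum)
open import Data.Integer using (ℤ; -_; 1ℤ)
open import Data.Product using (_×_)
open import Data.Sum using (_⊎_)
open import Relation.Nullary using (¬_)
open import Relation.Binary.PropositionalEquality using (_≡_)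
open import Function.Bundles using (_↔_; Inverse)
open import Function.Definitions using (Bijective)

inversions : {n : ℕ} → (Fin n → Fin n) → ℕ
inversions {n} σ =
  sum (map (λ i → sum (map (λ j →
    if (toℕ i <ᵇ toℕ j) ∧ (toℕ (σ j) <ᵇ toℕ (σ i)) then 1 else 0)
    (allFin n))) (allFin n))

minusOnePow : ℕ → ℤ
minusOnePow zero    = 1ℤ
minusOnePow (suc k) = - minusOnePow k

sgnPerm : {n : ℕ} → (Fin n → Fin n) → ℤ
sgnPerm σ = minusOnePow (inversions σ)

-- A bipartite graph Γ with sides U = Fin p, V = Fin q, given by its
-- (Boolean) adjacency A u v  ("{u,v} ∈ E").  Neighbourhoods as subsets.

allB : {A : Set} → (A → Bool) → List A → Bool
allB P = foldr (λ x b → P x ∧ b) true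

module CFI {p q : ℕ} (A : Fin p → Fin q → Bool) where

  NU : Fin p → Subset q
  NU u = tabulate (λ v → A u v)

  NV : Fin q → Subset p
  NV v = tabulate (λ u → A u v)

  evenB : ℕ → Bool
  evenB k = k % 2 ≡ᵇ 0

  okInU : Fin p → Subset q → Bool
  okInU u S = allB (λ v → not (lookup S v) ∨ A u v) (allFin q) ∧ evenB ∣ S ∣

  okInV : Fin q → Subset p → Bool
  okInV v S = allB (λ u → not (lookup S u) ∨ A u v) (allFin p) ∧ evenB ∣ S ∣

  -- X = ⋃_{u∈U} I_u ∪ ⋃_{v∈V} O_v
  data Xv : Set where
    xIn  : (u : Fin p) (S : Subset q) → T (okInU u S) → Xv
    xOut : (v : Fin q) (u : Fin p) → T (A u v) → Bool → Xv

  -- Y = ⋃_{v∈V} I_v ∪ ⋃_{u∈U} O_u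
  data Yv : Set where
    yIn  : (v : Fin q) (S : Subset p) → T (okInV v S) → Yv
    yOut : (u : Fin p) (v : Fin q) → T (A u v) → Bool → Yv

  data Adj : Xv → Yv → Set where
    inU-out : ∀ u S h v h' → Adj (xIn u S h) (yOut u v h' (lookup S v))
    out-inV : ∀ v u h S h' → Adj (xOut v u h (lookup S u)) (yIn v S h')
    out-out : ∀ v u h h' b → Adj (xOut v u h b) (yOut u v h' b)

  IsPerfectMatching : (Xv → Yv) → Set
  IsPerfectMatching μ = Bijective _≡_ _≡_ μ × (∀ x → Adj x (μ x))

  EdgeIn : (Xv → Yv) → (u : Fin p) (v : Fin q) → T (A u v) → Bool → Set
  EdgeIn μ u v h b = μ (xOut v u h b) ≡ yOut u v h b

  Uniform : (Xv → Yv) → Set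
  Uniform μ = ∀ u v (h : T (A u v)) → ¬ (EdgeIn μ u v h false × EdgeIn μ u v h true)

  ExactlyOne : Set → Set → Set
  ExactlyOne P Q = (P × ¬ Q) ⊎ (¬ P × Q)

  SubsetE : (Fin p → Fin q → Bool) → Set
  SubsetE F = ∀ u v → T (F u v) → T (A u v)

  IsTwoFactor : (Fin p → Fin q → Bool) → Set
  IsTwoFactor F = SubsetE F
                × (∀ u → ∣ tabulate (λ v → F u v) ∣ ≡ 2)
                × (∀ v → ∣ tabulate (λ u → F u v) ∣ ≡ 2)

  -- μ ∈ μ(F,f); f : F → {0,1} (0 = false, 1 = true)
  InMuFf : (F : Fin p → Fin q → Bool) → SubsetE F →
           ((u : Fin p) (v : Fin q) → T (F u v) → Bool) → (Xv → Yv) → Set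
  InMuFf F FE f μ =
      IsPerfectMatching μ
    × Uniform μ
    × (∀ u v (h : T (A u v)) →
         (T (F u v) → ExactlyOne (EdgeIn μ u v h false) (EdgeIn μ u v h true))
       × (ExactlyOne (EdgeIn μ u v h false) (EdgeIn μ u v h true) → T (F u v)))
    × (∀ u v (hF : T (F u v)) → EdgeIn μ u v (FE u v hF) (f u v hF))

  sgnPM : {n : ℕ} → Xv ↔ Fin n → Yv ↔ Fin n → (Xv → Yv) → ℤ
  sgnPM η η' μ = sgnPerm (λ i → Inverse.to η' (μ (Inverse.from η i)))

-- Let ρ = μ₁⁻¹ ∘ μ₂, a permutation of X with μ₂ = μ₁ ∘ ρ. Signs are parities of inversion
-- counts, which add under composition, so sgn μ₂ = sgn μ₁ · sgn ρ, and ρ is even once ρ³ = id.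
-- Both matchings cover the same outer vertices by F-edges, and ρ fixes these. In the gadget of a
-- vertex of Γ the four inner vertices are matched with the four remaining outer vertices, and the
-- parity condition on inner vertices leaves exactly two ways to do so, which differ by a 3-cycle.
-- Hence ρ³ = id.

module Submission where

open import Defs

open import Algebra.Bundles using (CommutativeRing)
open import Data.Bool using (Bool; true; false; T; not; _∧_; _∨_; _xor_; if_then_else_)
open import Data.Bool.Properties
  using (T-∧; T-irrelevant; not-¬; ¬-not; xor-inverseˡ; xor-same; xor-∧-commutativeRing)
import Data.Bool.Properties as Boolₚ
open import Data.Empty using (⊥-elim)
open import Data.Fin using (Fin; zero; suc; toℕ; inject₁)
import Data.Fin.Induction as Fin
open import Data.Fin.Properties using (toℕ-injective; toℕ-inject₁)
import Data.Fin.Properties as Fin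
open import Data.Fin.Subset using (Subset; ∣_∣)
open import Data.Integer using (_◃_)
open import Data.Integer.Properties using (neg-involutive)
open import Data.List using (allFin; map)
import Data.List as List
open import Data.List.Properties using (map-tabulate)
open import Data.Nat using (ℕ; zero; suc; _+_; _%_; _≡ᵇ_; _<ᵇ_; _≤_; _<_; z≤n; s≤s; z<s; parity)
open import Data.Nat.ListAction using () renaming (sum to sumList)
open import Data.Nat.Properties
  using ( +-comm; +-assoc; +-identityʳ; <ᵇ⇒<; <⇒<ᵇ; <-irrefl; <-asym; <-≤-trans; ≤-refl; <-cmp
        ; +-mono-≤; m≤m+n; ≮⇒≥; ≤⇒≯; m+n≡0⇒m≡0; m+n≡0⇒n≡0; _<?_; module ≤-Reasoning)
import Data.Nat.Properties as ℕₚ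
open import Data.Nat.Solver using (module +-*-Solver)
open import Data.Parity.Base as ℙ using (Parity; 0ℙ; 1ℙ; _⁻¹; toSign)
open import Data.Parity.Properties using (⁻¹-selfInverse; suc-homo-⁻¹)
import Data.Parity.Properties as ℙₚ
open import Data.Product using (Σ; _×_; _,_; proj₁; proj₂; ∃)
open import Data.Sum using (_⊎_; inj₁; inj₂)
import Data.Vec as Vec
open import Data.Vec using (tabulate)
import Data.Vec.Properties as Vecₚ
open import Function using (_∘_; id)
open import Function.Bundles using (Equivalence; Injection; Inverse; _↔_)
open import Function.Consequences.Propositional using (inverseʳ⇒injective; strictlyInverseʳ⇒inverseʳ)
open import Function.Definitions using (Injective)
open import Function.Properties.Inverse using (↔⇒↣; ↔-sym)
open import Induction.WellFounded using (module All)
open import Level using (0ℓ)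
open import Relation.Binary.Definitions using (tri<; tri≈; tri>)
open import Relation.Binary.PropositionalEquality
  using (_≡_; _≢_; _≗_; refl; sym; trans; cong; cong₂; subst; module ≡-Reasoning)
open import Relation.Nullary using (¬_; yes; no; does)

open import Algebra.Properties.Monoid.Sum ℕₚ.+-0-monoid using (sum; sum-syntax; sum-cong-≗; sum-replicate-zero)
open import Algebra.Properties.CommutativeSemigroup ℕₚ.+-commutativeSemigroup using (x∙yz≈y∙xz)
open import Algebra.Properties.CommutativeSemigroup (CommutativeRing.+-commutativeSemigroup xor-∧-commutativeRing)
  using () renaming (interchange to xor-interchange)
open import Algebra.Properties.Group (CommutativeRing.+-group xor-∧-commutativeRing)
  using () renaming (∙-cancelʳ to xor-cancelʳ)

-- Signs of permutations

strictlyInverseʳ⇒injective : ∀ {A B : Set} (f : A → B) (g : B → A) → (∀ x → g (f x) ≡ x) → Injective _≡_ _≡_ f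
strictlyInverseʳ⇒injective f g gf = inverseʳ⇒injective {f⁻¹ = g} f (strictlyInverseʳ⇒inverseʳ f gf)

bit : Bool → ℕ
bit b = if b then 1 else 0

𝟙[_<_] : ℕ → ℕ → ℕ
𝟙[ a < b ] = bit (a <ᵇ b)

𝟙<-yes : ∀ {a b} → a < b → 𝟙[ a < b ] ≡ 1
𝟙<-yes {a} {b} a<b with a <ᵇ b | <⇒<ᵇ a<b
... | true | _ = refl

𝟙<-no : ∀ {a b} → ¬ a < b → 𝟙[ a < b ] ≡ 0
𝟙<-no {a} {b} a≮b with a <ᵇ b | <ᵇ⇒< a b
... | false | _ = refl
... | true | lt = ⊥-elim (a≮b (lt _))

𝟙<≡0⇒≥ : ∀ {a b} → 𝟙[ a < b ] ≡ 0 → b ≤ a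
𝟙<≡0⇒≥ {a} {b} e = ≮⇒≥ λ a<b → 1≢0 (trans (sym (𝟙<-yes a<b)) e)
  where
  1≢0 : 1 ≢ 0
  1≢0 ()

𝟙<-monoʳ : ∀ a {b c} → b ≤ c → 𝟙[ a < b ] ≤ 𝟙[ a < c ]
𝟙<-monoʳ a {b} {c} b≤c with a <ᵇ b in eq
... | false = z≤n
... | true rewrite 𝟙<-yes (<-≤-trans (<ᵇ⇒< a b (subst T (sym eq) _)) b≤c) = ≤-refl

∑-mono-≤ : ∀ {n} {f g : Fin n → ℕ} → (∀ i → f i ≤ g i) → sum f ≤ sum g
∑-mono-≤ {zero}  f≤g = z≤n
∑-mono-≤ {suc n} f≤g = +-mono-≤ (f≤g zero) (∑-mono-≤ (f≤g ∘ suc))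

∑≡0⇒≡0 : ∀ {n} (f : Fin n → ℕ) → sum f ≡ 0 → ∀ i → f i ≡ 0
∑≡0⇒≡0 f e zero    = m+n≡0⇒m≡0 (f zero) e
∑≡0⇒≡0 f e (suc i) = ∑≡0⇒≡0 (f ∘ suc) (m+n≡0⇒n≡0 (f zero) e) i

sumList-tabulate : ∀ {n} (f : Fin n → ℕ) → sumList (List.tabulate f) ≡ sum f
sumList-tabulate {zero}  f = refl
sumList-tabulate {suc n} f = cong (f zero +_) (sumList-tabulate (f ∘ suc))

sumList-allFin : ∀ {n} (f : Fin n → ℕ) → sumList (map f (allFin n)) ≡ sum f
sumList-allFin f = trans (cong sumList (map-tabulate id f)) (sumList-tabulate f)

countBelow : ℕ → {n : ℕ} → (Fin n → ℕ) → ℕ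
countBelow a {n} h = ∑[ j < n ] 𝟙[ h j < a ]

inversionCount : {n : ℕ} → (Fin n → ℕ) → ℕ
inversionCount {zero}  h = 0
inversionCount {suc n} h = countBelow (h zero) (h ∘ suc) + inversionCount (h ∘ suc)

inversionCount-cong : ∀ {n} {g h : Fin n → ℕ} → g ≗ h → inversionCount g ≡ inversionCount h
inversionCount-cong {zero}  g≗h = refl
inversionCount-cong {suc n} g≗h =
  cong₂ _+_ (sum-cong-≗ λ j → cong₂ 𝟙[_<_] (g≗h (suc j)) (g≗h zero)) (inversionCount-cong (g≗h ∘ suc))

inversions≡inversionCount : ∀ {n} (σ : Fin n → Fin n) → inversions σ ≡ inversionCount (toℕ ∘ σ)
inversions≡inversionCount {n} σ = begin
  inversions σ
    ≡⟨ sumList-allFin {n} _ ⟩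
  ∑[ i < n ] sumList (map (pairInverted i) (allFin n))
    ≡⟨ sum-cong-≗ (λ i → sumList-allFin (pairInverted i)) ⟩
  ∑[ i < n ] ∑[ j < n ] pairInverted i j
    ≡⟨ rows (toℕ ∘ σ) ⟩
  inversionCount (toℕ ∘ σ) ∎
  where
  open ≡-Reasoning
  pairInverted : Fin n → Fin n → ℕ
  pairInverted i j = if (toℕ i <ᵇ toℕ j) ∧ (toℕ (σ j) <ᵇ toℕ (σ i)) then 1 else 0
  rows : ∀ {m} (h : Fin m → ℕ) →
    (∑[ i < m ] ∑[ j < m ] (if (toℕ i <ᵇ toℕ j) ∧ (h j <ᵇ h i) then 1 else 0)) ≡ inversionCount h
  rows {zero}  h = refl
  rows {suc m} h = cong (countBelow (h zero) (h ∘ suc) +_) (rows (h ∘ suc))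

swapAdj : ∀ {n} → Fin n → Fin (suc n) → Fin (suc n)
swapAdj zero    zero          = suc zero
swapAdj zero    (suc zero)    = zero
swapAdj zero    (suc (suc j)) = suc (suc j)
swapAdj (suc k) zero          = zero
swapAdj (suc k) (suc j)       = suc (swapAdj k j)

swapAdj-involutive : ∀ {n} (k : Fin n) → swapAdj k ∘ swapAdj k ≗ id
swapAdj-involutive zero    zero          = refl
swapAdj-involutive zero    (suc zero)    = refl
swapAdj-involutive zero    (suc (suc j)) = refl
swapAdj-involutive (suc k) zero          = refl
swapAdj-involutive (suc k) (suc j)       = cong suc (swapAdj-involutive k j)

swapAdj-inject₁ : ∀ {n} (k : Fin n) → swapAdj k (inject₁ k) ≡ suc k
swapAdj-inject₁ zero    = refl
swapAdj-inject₁ (suc k) = cong suc (swapAdj-inject₁ k)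

swapAdj-suc : ∀ {n} (k : Fin n) → swapAdj k (suc k) ≡ inject₁ k
swapAdj-suc zero    = refl
swapAdj-suc (suc k) = cong suc (swapAdj-suc k)

inject₁≢suc : ∀ {n} (k : Fin n) → inject₁ k ≢ suc k
inject₁≢suc k e = <-irrefl (trans (sym (toℕ-inject₁ k)) (cong toℕ e)) ≤-refl

countBelow-swapAdj : ∀ {n} a (k : Fin n) (h : Fin (suc n) → ℕ) →
  countBelow a (h ∘ swapAdj k) ≡ countBelow a h
countBelow-swapAdj a zero    h = x∙yz≈y∙xz 𝟙[ h (suc zero) < a ] 𝟙[ h zero < a ] _
countBelow-swapAdj a (suc k) h = cong (𝟙[ h zero < a ] +_) (countBelow-swapAdj a k (h ∘ suc))

-- Only the relative order of the two swapped entries changes; stated without subtraction.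
inversionCount-swapAdj : ∀ {n} (k : Fin n) (h : Fin (suc n) → ℕ) →
  inversionCount (h ∘ swapAdj k) + 𝟙[ h (suc k) < h (inject₁ k) ] ≡
  inversionCount h + 𝟙[ h (inject₁ k) < h (suc k) ]
inversionCount-swapAdj zero h =
  solve 5 (λ a b c d e → ((a :+ c) :+ (d :+ e)) :+ b := ((b :+ d) :+ (c :+ e)) :+ a) refl
    𝟙[ h zero < h (suc zero) ] 𝟙[ h (suc zero) < h zero ]
    (countBelow (h (suc zero)) (λ i → h (suc (suc i)))) (countBelow (h zero) (λ i → h (suc (suc i))))
    (inversionCount (λ i → h (suc (suc i))))
  where open +-*-Solver
inversionCount-swapAdj (suc k) h = begin
  (C′ + I′) + 𝟙[ y < x ]   ≡⟨ +-assoc C′ I′ 𝟙[ y < x ] ⟩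
  C′ + (I′ + 𝟙[ y < x ])   ≡⟨ cong₂ _+_ (countBelow-swapAdj (h zero) k (h ∘ suc)) (inversionCount-swapAdj k (h ∘ suc)) ⟩
  C + (I + 𝟙[ x < y ])     ≡⟨ +-assoc C I 𝟙[ x < y ] ⟨
  (C + I) + 𝟙[ x < y ]     ∎
  where
  open ≡-Reasoning
  x = h (suc (inject₁ k))
  y = h (suc (suc k))
  C′ = countBelow (h zero) (h ∘ suc ∘ swapAdj k)
  I′ = inversionCount (h ∘ suc ∘ swapAdj k)
  C = countBelow (h zero) (h ∘ suc)
  I = inversionCount (h ∘ suc)

inversionCount-swapAdj-< : ∀ {n} (k : Fin n) (h : Fin (suc n) → ℕ) → h (inject₁ k) < h (suc k) →
  inversionCount (h ∘ swapAdj k) ≡ suc (inversionCount h)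
inversionCount-swapAdj-< k h x<y = begin
  inversionCount (h ∘ swapAdj k)                        ≡⟨ +-identityʳ _ ⟨
  inversionCount (h ∘ swapAdj k) + 0                    ≡⟨ cong (inversionCount (h ∘ swapAdj k) +_) (𝟙<-no (<-asym x<y)) ⟨
  inversionCount (h ∘ swapAdj k) + 𝟙[ h (suc k) < h (inject₁ k) ] ≡⟨ inversionCount-swapAdj k h ⟩
  inversionCount h + 𝟙[ h (inject₁ k) < h (suc k) ]      ≡⟨ cong (inversionCount h +_) (𝟙<-yes x<y) ⟩
  inversionCount h + 1                                  ≡⟨ +-comm _ 1 ⟩
  suc (inversionCount h)                                ∎
  where open ≡-Reasoning

inversionCount-swapAdj-> : ∀ {n} (k : Fin n) (h : Fin (suc n) → ℕ) → h (suc k) < h (inject₁ k) →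
  inversionCount h ≡ suc (inversionCount (h ∘ swapAdj k))
inversionCount-swapAdj-> k h y<x = begin
  inversionCount h                                 ≡⟨ inversionCount-cong (cong h ∘ swapAdj-involutive k) ⟨
  inversionCount (h ∘ swapAdj k ∘ swapAdj k)       ≡⟨ inversionCount-swapAdj-< k (h ∘ swapAdj k) h′x<h′y ⟩
  suc (inversionCount (h ∘ swapAdj k))             ∎
  where
  open ≡-Reasoning
  h′x<h′y : h (swapAdj k (inject₁ k)) < h (swapAdj k (suc k))
  h′x<h′y rewrite swapAdj-inject₁ k | swapAdj-suc k = y<x

parity-suc : ∀ m → parity (suc m) ≡ parity m ⁻¹
parity-suc m = sym (⁻¹-selfInverse {parity (suc m)} (suc-homo-⁻¹ m))

parity-inversionCount-swapAdj : ∀ {n} (k : Fin n) (h : Fin (suc n) → ℕ) → h (inject₁ k) ≢ h (suc k) →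
  parity (inversionCount (h ∘ swapAdj k)) ≡ parity (inversionCount h) ⁻¹
parity-inversionCount-swapAdj k h x≢y with <-cmp (h (inject₁ k)) (h (suc k))
... | tri< x<y _ _ = trans (cong parity (inversionCount-swapAdj-< k h x<y)) (parity-suc (inversionCount h))
... | tri≈ _ x≡y _ = ⊥-elim (x≢y x≡y)
... | tri> _ _ y<x = sym (⁻¹-selfInverse {parity (inversionCount (h ∘ swapAdj k))}
  (sym (trans (cong parity (inversionCount-swapAdj-> k h y<x)) (parity-suc (inversionCount (h ∘ swapAdj k))))))

descent : ∀ {n} (h : Fin (suc n) → ℕ) → 0 < inversionCount h → ∃ λ k → h (suc k) < h (inject₁ k)
descent {zero}  h ()
descent {suc n} h 0<I with h (suc zero) <? h zero
... | yes h₁<h₀ = zero , h₁<h₀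
... | no h₁≮h₀ with inversionCount (h ∘ suc) in tailI
...   | suc _ = let k , d = descent (h ∘ suc) (subst (0 <_) (sym tailI) z<s) in suc k , d
...   | zero  = ⊥-elim (<-irrefl refl (begin-strict
  0                                                    <⟨ 0<I ⟩
  countBelow (h zero) (h ∘ suc) + 0                    ≡⟨ +-identityʳ _ ⟩
  𝟙[ h (suc zero) < h zero ] + countBelow (h zero) h₂₊ ≡⟨ cong (_+ countBelow (h zero) h₂₊) (𝟙<-no h₁≮h₀) ⟩
  countBelow (h zero) h₂₊                              ≤⟨ ∑-mono-≤ (λ j → 𝟙<-monoʳ (h₂₊ j) (≮⇒≥ h₁≮h₀)) ⟩
  countBelow (h (suc zero)) h₂₊                        ≤⟨ m≤m+n _ _ ⟩
  inversionCount (h ∘ suc)                             ≡⟨ tailI ⟩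
  0                                                    ∎))
  where
  open ≤-Reasoning
  h₂₊ : Fin n → ℕ
  h₂₊ i = h (suc (suc i))

inversionCount≡0⇒sorted : ∀ {n} (h : Fin n → ℕ) → inversionCount h ≡ 0 →
  ∀ i j → toℕ i < toℕ j → h i ≤ h j
inversionCount≡0⇒sorted {suc n} h I≡0 zero    (suc j) _ =
  𝟙<≡0⇒≥ (∑≡0⇒≡0 _ (m+n≡0⇒m≡0 _ I≡0) j)
inversionCount≡0⇒sorted {suc n} h I≡0 (suc i) (suc j) (s≤s i<j) =
  inversionCount≡0⇒sorted (h ∘ suc) (m+n≡0⇒n≡0 (countBelow (h zero) (h ∘ suc)) I≡0) i j i<j

sorted⇒inversionCount≡0 : ∀ {n} (h : Fin n → ℕ) → (∀ i j → toℕ i < toℕ j → h i ≤ h j) →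
  inversionCount h ≡ 0
sorted⇒inversionCount≡0 {zero}  h sorted = refl
sorted⇒inversionCount≡0 {suc n} h sorted = cong₂ _+_
  (trans (sum-cong-≗ λ j → 𝟙<-no (≤⇒≯ (sorted zero (suc j) z<s))) (sum-replicate-zero n))
  (sorted⇒inversionCount≡0 (h ∘ suc) λ i j i<j → sorted (suc i) (suc j) (s≤s i<j))

sorted-surjection⇒id : ∀ {n} (π π⁻¹ : Fin n → Fin n) → π ∘ π⁻¹ ≗ id → Injective _≡_ _≡_ π →
  (∀ i j → toℕ i < toℕ j → toℕ (π i) ≤ toℕ (π j)) → π ≗ id
sorted-surjection⇒id {n} π π⁻¹ ππ⁻¹ π-inj sorted = All.wfRec Fin.<-wellFounded 0ℓ (λ i → π i ≡ i) step
  where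
  step : ∀ i → (∀ {j} → toℕ j < toℕ i → π j ≡ j) → π i ≡ i
  step i below with Fin.<-cmp (π i) i
  ... | tri< πi<i _ _ = π-inj (below πi<i)
  ... | tri≈ _ πi≡i _ = πi≡i
  ... | tri> _ _ i<πi with Fin.<-cmp (π⁻¹ i) i
  ...   | tri< j<i _ _ = ⊥-elim (Fin.<-irrefl (trans (sym (below j<i)) (ππ⁻¹ i)) j<i)
  ...   | tri≈ _ j≡i _ = trans (cong π (sym j≡i)) (ππ⁻¹ i)
  ...   | tri> _ _ i<j = ⊥-elim (<-irrefl refl (<-≤-trans i<πi
            (subst (λ k → toℕ (π i) ≤ toℕ k) (ππ⁻¹ i) (sorted i (π⁻¹ i) i<j))))

invParity : ∀ {n} → (Fin n → Fin n) → Parity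
invParity σ = parity (inversionCount (toℕ ∘ σ))

-- Induction on the inversion count of π: an adjacent descent of π, once swapped away,
-- lowers that count by one and flips the parities of both σ ∘ π and π.
invParity-∘ : ∀ {n} (σ π π⁻¹ : Fin n → Fin n) → Injective _≡_ _≡_ σ →
  π ∘ π⁻¹ ≗ id → π⁻¹ ∘ π ≗ id → invParity (σ ∘ π) ≡ invParity σ ℙ.+ invParity π
invParity-∘ σ π π⁻¹ σ-inj ππ⁻¹ π⁻¹π = go _ σ-inj π π⁻¹ ππ⁻¹ π⁻¹π refl
  where
  ⁻¹-cancel : ∀ p q r → p ⁻¹ ≡ q ℙ.+ r ⁻¹ → p ≡ q ℙ.+ r
  ⁻¹-cancel 0ℙ 0ℙ 0ℙ e = refl
  ⁻¹-cancel 0ℙ 0ℙ 1ℙ ()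
  ⁻¹-cancel 0ℙ 1ℙ 0ℙ ()
  ⁻¹-cancel 0ℙ 1ℙ 1ℙ e = refl
  ⁻¹-cancel 1ℙ 0ℙ 0ℙ ()
  ⁻¹-cancel 1ℙ 0ℙ 1ℙ e = refl
  ⁻¹-cancel 1ℙ 1ℙ 0ℙ e = refl
  ⁻¹-cancel 1ℙ 1ℙ 1ℙ ()

  go : ∀ {n} (m : ℕ) {σ : Fin n → Fin n} → Injective _≡_ _≡_ σ →
    ∀ π π⁻¹ → π ∘ π⁻¹ ≗ id → π⁻¹ ∘ π ≗ id → inversionCount (toℕ ∘ π) ≡ m →
    invParity (σ ∘ π) ≡ invParity σ ℙ.+ invParity π
  go zero {σ} σ-inj π π⁻¹ ππ⁻¹ π⁻¹π I≡0 = begin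
    invParity (σ ∘ π)          ≡⟨ cong parity (inversionCount-cong (cong (toℕ ∘ σ) ∘ π≗id)) ⟩
    invParity σ                ≡⟨ ℙₚ.+-identityʳ (invParity σ) ⟨
    invParity σ ℙ.+ parity 0   ≡⟨ cong (λ m → invParity σ ℙ.+ parity m) I≡0 ⟨
    invParity σ ℙ.+ invParity π ∎
    where
    open ≡-Reasoning
    π≗id : π ≗ id
    π≗id = sorted-surjection⇒id π π⁻¹ ππ⁻¹ (strictlyInverseʳ⇒injective π π⁻¹ π⁻¹π)
             (inversionCount≡0⇒sorted (toℕ ∘ π) I≡0)
  go {zero}  (suc m) σ-inj π π⁻¹ ππ⁻¹ π⁻¹π ()
  go {suc n} (suc m) {σ} σ-inj π π⁻¹ ππ⁻¹ π⁻¹π I≡1+m =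
    ⁻¹-cancel (invParity (σ ∘ π)) (invParity σ) (invParity π) (begin
      invParity (σ ∘ π) ⁻¹
        ≡⟨ parity-inversionCount-swapAdj k (toℕ ∘ σ ∘ π) (distinct λ e → σ-inj (toℕ-injective e)) ⟨
      invParity (σ ∘ π′)
        ≡⟨ go m σ-inj π′ (swapAdj k ∘ π⁻¹) ππ⁻¹′ π⁻¹π′ I′≡m ⟩
      invParity σ ℙ.+ invParity π′
        ≡⟨ cong (invParity σ ℙ.+_) (parity-inversionCount-swapAdj k (toℕ ∘ π) (distinct λ e → toℕ-injective e)) ⟩
      invParity σ ℙ.+ invParity π ⁻¹ ∎)
    where
    open ≡-Reasoning
    d = descent (toℕ ∘ π) (subst (0 <_) (sym I≡1+m) z<s)
    k = proj₁ d
    π′ = π ∘ swapAdj k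
    ππ⁻¹′ : π′ ∘ (swapAdj k ∘ π⁻¹) ≗ id
    ππ⁻¹′ i = trans (cong π (swapAdj-involutive k (π⁻¹ i))) (ππ⁻¹ i)
    π⁻¹π′ : (swapAdj k ∘ π⁻¹) ∘ π′ ≗ id
    π⁻¹π′ i = trans (cong (swapAdj k) (π⁻¹π (swapAdj k i))) (swapAdj-involutive k i)
    I′≡m : inversionCount (toℕ ∘ π′) ≡ m
    I′≡m = ℕₚ.suc-injective (trans (sym (inversionCount-swapAdj-> k (toℕ ∘ π) (proj₂ d))) I≡1+m)
    distinct : ∀ {A : Set} {f : Fin (suc n) → A} → (∀ {x y} → f x ≡ f y → x ≡ y) →
      f (π (inject₁ k)) ≢ f (π (suc k))
    distinct f-inj e = inject₁≢suc k (strictlyInverseʳ⇒injective π π⁻¹ π⁻¹π (f-inj e))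

invParity-id : ∀ {n} → invParity {n} id ≡ 0ℙ
invParity-id {n} = cong parity (sorted⇒inversionCount≡0 (toℕ {n}) λ _ _ → ℕₚ.<⇒≤)

-- p = p + p + p for every parity p, and by multiplicativity p + p + p is the parity of π³ = id.
invParity-order3 : ∀ {n} (π : Fin n → Fin n) → π ∘ π ∘ π ≗ id → invParity π ≡ 0ℙ
invParity-order3 {n} π π³≗id = begin
  invParity π                           ≡⟨ cong (ℙ._+ invParity π) (ℙₚ.p+p≡0ℙ (invParity π)) ⟨
  (p ℙ.+ p) ℙ.+ p                       ≡⟨ cong (ℙ._+ p) (invParity-∘ π π (π ∘ π) π-inj π³≗id π³≗id) ⟨
  invParity (π ∘ π) ℙ.+ p               ≡⟨ invParity-∘ (π ∘ π) π (π ∘ π) (π-inj ∘ π-inj) π³≗id π³≗id ⟨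
  invParity (π ∘ π ∘ π)                 ≡⟨ cong parity (inversionCount-cong (cong toℕ ∘ π³≗id)) ⟩
  invParity {n} id                      ≡⟨ invParity-id {n} ⟩
  0ℙ                                    ∎
  where
  open ≡-Reasoning
  p = invParity π
  π-inj : Injective _≡_ _≡_ π
  π-inj = strictlyInverseʳ⇒injective π (π ∘ π) π³≗id

minusOnePow≡parity : ∀ k → minusOnePow k ≡ toSign (parity k) ◃ 1
minusOnePow≡parity zero          = refl
minusOnePow≡parity (suc zero)    = refl
minusOnePow≡parity (suc (suc k)) = trans (neg-involutive (minusOnePow k)) (minusOnePow≡parity k)

sgnPerm≡invParity : ∀ {n} (σ : Fin n → Fin n) → sgnPerm σ ≡ toSign (invParity σ) ◃ 1
sgnPerm≡invParity σ =
  trans (cong minusOnePow (inversions≡inversionCount σ)) (minusOnePow≡parity (inversionCount (toℕ ∘ σ)))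

sgnPerm-∘-order3 : ∀ {n} (σ π : Fin n → Fin n) → Injective _≡_ _≡_ σ → π ∘ π ∘ π ≗ id →
  sgnPerm (σ ∘ π) ≡ sgnPerm σ
sgnPerm-∘-order3 σ π σ-inj π³≗id = begin
  sgnPerm (σ ∘ π)                         ≡⟨ sgnPerm≡invParity (σ ∘ π) ⟩
  toSign (invParity (σ ∘ π)) ◃ 1          ≡⟨ cong (λ p → toSign p ◃ 1) (invParity-∘ σ π (π ∘ π) σ-inj π³≗id π³≗id) ⟩
  toSign (invParity σ ℙ.+ invParity π) ◃ 1 ≡⟨ cong (λ p → toSign (invParity σ ℙ.+ p) ◃ 1) (invParity-order3 π π³≗id) ⟩
  toSign (invParity σ ℙ.+ 0ℙ) ◃ 1         ≡⟨ cong (λ p → toSign p ◃ 1) (ℙₚ.+-identityʳ (invParity σ)) ⟩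
  toSign (invParity σ) ◃ 1                ≡⟨ sgnPerm≡invParity σ ⟨
  sgnPerm σ                               ∎
  where open ≡-Reasoning

sgnPerm-conj-order3 : ∀ {n} {X Y : Set} (η : X ↔ Fin n) (η′ : Y ↔ Fin n) (μ₁ μ₂ : X → Y) (ρ : X → X) →
  Injective _≡_ _≡_ μ₁ → ρ ∘ ρ ∘ ρ ≗ id → μ₁ ∘ ρ ≗ μ₂ →
  sgnPerm (Inverse.to η′ ∘ μ₁ ∘ Inverse.from η) ≡ sgnPerm (Inverse.to η′ ∘ μ₂ ∘ Inverse.from η)
sgnPerm-conj-order3 η η′ μ₁ μ₂ ρ μ₁-inj ρ³≗id μ₁ρ≗μ₂ = begin
  sgnPerm σ₁        ≡⟨ sgnPerm-∘-order3 σ₁ π σ₁-inj π³≗id ⟨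
  sgnPerm (σ₁ ∘ π)  ≡⟨ sgnPerm-cong σ₁π≗σ₂ ⟩
  sgnPerm σ₂        ∎
  where
  open ≡-Reasoning
  module η = Inverse η
  module η′ = Inverse η′
  σ₁ = η′.to ∘ μ₁ ∘ η.from
  σ₂ = η′.to ∘ μ₂ ∘ η.from
  π = η.to ∘ ρ ∘ η.from
  sgnPerm-cong : ∀ {σ σ′ : Fin _ → Fin _} → σ ≗ σ′ → sgnPerm σ ≡ sgnPerm σ′
  sgnPerm-cong {σ} {σ′} σ≗σ′ = trans (sgnPerm≡invParity σ)
    (trans (cong (λ m → toSign (parity m) ◃ 1) (inversionCount-cong (cong toℕ ∘ σ≗σ′))) (sym (sgnPerm≡invParity σ′)))
  σ₁-inj : Injective _≡_ _≡_ σ₁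
  σ₁-inj = Injection.injective (↔⇒↣ (↔-sym η)) ∘ μ₁-inj ∘ Injection.injective (↔⇒↣ η′)
  π³≗id : π ∘ π ∘ π ≗ id
  π³≗id i = begin
    η.to (ρ (η.from (η.to (ρ (η.from (η.to (ρ (η.from i))))))))
      ≡⟨ cong (λ x → η.to (ρ (η.from (η.to (ρ x))))) (η.strictlyInverseʳ _) ⟩
    η.to (ρ (η.from (η.to (ρ (ρ (η.from i))))))                 ≡⟨ cong (η.to ∘ ρ) (η.strictlyInverseʳ _) ⟩
    η.to (ρ (ρ (ρ (η.from i))))                                 ≡⟨ cong η.to (ρ³≗id (η.from i)) ⟩
    η.to (η.from i)                                             ≡⟨ η.strictlyInverseˡ i ⟩
    i                                                           ∎
  σ₁π≗σ₂ : σ₁ ∘ π ≗ σ₂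
  σ₁π≗σ₂ i = cong η′.to (trans (cong μ₁ (η.strictlyInverseʳ _)) (μ₁ρ≗μ₂ (η.from i)))

-- Vertices of degree three with two edges in a 2-factor

count : ∀ {m} → (Fin m → Bool) → ℕ
count {m} g = ∑[ v < m ] bit (g v)

∣tabulate∣≡count : ∀ {m} (g : Fin m → Bool) → ∣ Vec.tabulate g ∣ ≡ count g
∣tabulate∣≡count {zero}  g = refl
∣tabulate∣≡count {suc m} g with g zero
... | true  = cong suc (∣tabulate∣≡count (g ∘ suc))
... | false = ∣tabulate∣≡count (g ∘ suc)

∣∣≡count : ∀ {m} (S : Subset m) → ∣ S ∣ ≡ count (Vec.lookup S)
∣∣≡count S = trans (cong ∣_∣ (sym (Vecₚ.tabulate∘lookup S))) (∣tabulate∣≡count (Vec.lookup S))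

remove : ∀ {m} → (Fin m → Bool) → Fin m → Fin m → Bool
remove g v x = if does (x Fin.≟ v) then false else g x

remove-≢ : ∀ {m} (g : Fin m → Bool) {v x} → x ≢ v → remove g v x ≡ g x
remove-≢ g {v} {x} x≢v with x Fin.≟ v
... | yes x≡v = ⊥-elim (x≢v x≡v)
... | no _    = refl

T-remove⁻ : ∀ {m} (g : Fin m → Bool) {v x} → T (remove g v x) → T (g x) × x ≢ v
T-remove⁻ g {v} {x} t with x Fin.≟ v
... | no x≢v = t , x≢v

count-remove : ∀ {m} (g : Fin m → Bool) v → count g ≡ bit (g v) + count (remove g v)
count-remove g zero    = refl
count-remove g (suc v) = begin
  bit (g zero) + count (g ∘ suc)                               ≡⟨ cong (bit (g zero) +_) (count-remove (g ∘ suc) v) ⟩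
  bit (g zero) + (bit (g (suc v)) + count (remove (g ∘ suc) v)) ≡⟨ x∙yz≈y∙xz (bit (g zero)) (bit (g (suc v))) _ ⟩
  bit (g (suc v)) + (bit (g zero) + count (remove (g ∘ suc) v)) ∎
  where open ≡-Reasoning

count≡0⇒¬T : ∀ {m} (g : Fin m → Bool) → count g ≡ 0 → ∀ v → ¬ T (g v)
count≡0⇒¬T g c≡0 v t with g v | ∑≡0⇒≡0 (bit ∘ g) c≡0 v
... | true | ()

¬T⇒count≡0 : ∀ {m} (g : Fin m → Bool) → (∀ v → ¬ T (g v)) → count g ≡ 0
¬T⇒count≡0 {m} g ¬g = trans (sum-cong-≗ λ v → bit-false (¬g v)) (sum-replicate-zero m)
  where
  bit-false : ∀ {b} → ¬ T b → bit b ≡ 0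
  bit-false {false} _ = refl
  bit-false {true}  ¬t = ⊥-elim (¬t _)

count≡suc : ∀ {m} (g : Fin m → Bool) {k} → count g ≡ suc k → ∃ λ v → T (g v) × count (remove g v) ≡ k
count≡suc {zero}  g ()
count≡suc {suc m} g c≡1+k with g zero in g₀
... | true  = zero , subst T (sym g₀) _ , ℕₚ.suc-injective c≡1+k
... | false = let v , t , c′ = count≡suc (g ∘ suc) c≡1+k in suc v , t , c′


T-remove⁺ : ∀ {m} (g : Fin m → Bool) {v x} → T (g x) → x ≢ v → T (remove g v x)
T-remove⁺ g t x≢v = subst T (sym (remove-≢ g x≢v)) t

count≡suc-remove : ∀ {m} (g : Fin m → Bool) {v} → T (g v) → count g ≡ suc (count (remove g v))
count≡suc-remove g {v} t with g v | count-remove g v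
... | true | c = c

record Star {m : ℕ} (N F : Fin m → Bool) : Set where
  field
    v₁ v₂ w : Fin m
    N-v₁    : T (N v₁)
    N-v₂    : T (N v₂)
    N-w     : T (N w)
    F-v₁    : T (F v₁)
    F-v₂    : T (F v₂)
    ¬F-w    : ¬ T (F w)
    v₁≢v₂   : v₁ ≢ v₂
    v₁≢w    : v₁ ≢ w
    v₂≢w    : v₂ ≢ w
    N-cover : ∀ v → T (N v) → v ≡ v₁ ⊎ v ≡ v₂ ⊎ v ≡ w

star : ∀ {m} (N F : Fin m → Bool) → count N ≡ 3 → count F ≡ 2 → (∀ v → T (F v) → T (N v)) → Star N F
star N F ∣N∣≡3 ∣F∣≡2 F⊆N = record
  { v₁ = v₁ ; v₂ = v₂ ; w = w
  ; N-v₁ = F⊆N v₁ F-v₁ ; N-v₂ = F⊆N v₂ F-v₂ ; N-w = N-w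
  ; F-v₁ = F-v₁ ; F-v₂ = F-v₂ ; ¬F-w = ¬F-w
  ; v₁≢v₂ = v₁≢v₂ ; v₁≢w = v₁≢w ; v₂≢w = v₂≢w
  ; N-cover = N-cover
  }
  where
  first = count≡suc F ∣F∣≡2
  v₁ = proj₁ first
  F-v₁ = proj₁ (proj₂ first)
  F₁ = remove F v₁
  second = count≡suc F₁ (proj₂ (proj₂ first))
  v₂ = proj₁ second
  F-v₂ = proj₁ (T-remove⁻ F (proj₁ (proj₂ second)))
  v₁≢v₂ : v₁ ≢ v₂
  v₁≢v₂ = proj₂ (T-remove⁻ F (proj₁ (proj₂ second))) ∘ sym
  N₂ = remove (remove N v₁) v₂
  ∣N₂∣≡1 : count N₂ ≡ 1
  ∣N₂∣≡1 = ℕₚ.suc-injective (ℕₚ.suc-injective (begin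
    suc (suc (count N₂))       ≡⟨ cong suc (count≡suc-remove (remove N v₁) (T-remove⁺ N (F⊆N v₂ F-v₂) (v₁≢v₂ ∘ sym))) ⟨
    suc (count (remove N v₁))  ≡⟨ count≡suc-remove N (F⊆N v₁ F-v₁) ⟨
    count N                    ≡⟨ ∣N∣≡3 ⟩
    3                          ∎))
    where open ≡-Reasoning
  third = count≡suc N₂ ∣N₂∣≡1
  w = proj₁ third
  N₂-w = T-remove⁻ (remove N v₁) (proj₁ (proj₂ third))
  N₁-w = T-remove⁻ N (proj₁ N₂-w)
  N-w = proj₁ N₁-w
  v₁≢w : v₁ ≢ w
  v₁≢w = proj₂ N₁-w ∘ sym
  v₂≢w : v₂ ≢ w
  v₂≢w = proj₂ N₂-w ∘ sym
  ¬F-w : ¬ T (F w)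
  ¬F-w t = count≡0⇒¬T (remove F₁ v₂) (proj₂ (proj₂ second)) w
    (T-remove⁺ F₁ (T-remove⁺ F t (v₁≢w ∘ sym)) (v₂≢w ∘ sym))
  N-cover : ∀ v → T (N v) → v ≡ v₁ ⊎ v ≡ v₂ ⊎ v ≡ w
  N-cover v t with v Fin.≟ v₁ | v Fin.≟ v₂ | v Fin.≟ w
  ... | yes v≡v₁ | _        | _       = inj₁ v≡v₁
  ... | no _     | yes v≡v₂ | _       = inj₂ (inj₁ v≡v₂)
  ... | no _     | no _     | yes v≡w = inj₂ (inj₂ v≡w)
  ... | no v≢v₁  | no v≢v₂  | no v≢w  = ⊥-elim (count≡0⇒¬T (remove N₂ w) (proj₂ (proj₂ third)) v
    (T-remove⁺ N₂ (T-remove⁺ (remove N v₁) (T-remove⁺ N t v≢v₁) v≢v₂) v≢w))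

T-allB-tabulate : ∀ {n} {A : Set} (P : A → Bool) (g : Fin n → A) → T (allB P (List.tabulate g)) → ∀ i → T (P (g i))
T-allB-tabulate P g t zero    = proj₁ (Equivalence.to T-∧ t)
T-allB-tabulate P g t (suc i) = T-allB-tabulate P (g ∘ suc) (proj₂ (Equivalence.to T-∧ t)) i

-- The inner vertices v_S (S ⊆ N(v), |S| even); definitionally CFI.okInU u and CFI.okInV v for N = N(u), N(v).
evenSubsetᵇ : ∀ {m} → (Fin m → Bool) → Subset m → Bool
evenSubsetᵇ {m} N S = allB (λ v → not (Vec.lookup S v) ∨ N v) (allFin m) ∧ (∣ S ∣ % 2 ≡ᵇ 0)

evenSubset-⊆ : ∀ {m} (N : Fin m → Bool) S → T (evenSubsetᵇ N S) → ∀ v → T (Vec.lookup S v) → T (N v)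
evenSubset-⊆ N S t v s = implied (Vec.lookup S v) (N v) s
  (T-allB-tabulate (λ v → not (Vec.lookup S v) ∨ N v) id (proj₁ (Equivalence.to T-∧ t)) v)
  where
  implied : ∀ a b → T a → T (not a ∨ b) → T b
  implied true true _ _ = _

even-three-bits : ∀ a b c → T ((bit a + (bit b + (bit c + 0))) % 2 ≡ᵇ 0) → c ≡ a xor b
even-three-bits true  true  true  ()
even-three-bits true  true  false _ = refl
even-three-bits true  false true  _ = refl
even-three-bits true  false false ()
even-three-bits false true  true  _ = refl
even-three-bits false true  false ()
even-three-bits false false true  ()
even-three-bits false false false _ = refl

module EvenSubsets {m : ℕ} {N F : Fin m → Bool} (st : Star N F) where
  open Star st

  count-star : (s : Fin m → Bool) → (∀ v → T (s v) → T (N v)) → count s ≡ bit (s v₁) + (bit (s v₂) + (bit (s w) + 0))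
  count-star s s⊆N = begin
    count s                                  ≡⟨ count-remove s v₁ ⟩
    bit (s v₁) + count s₁                    ≡⟨ cong (bit (s v₁) +_) (count-remove s₁ v₂) ⟩
    bit (s v₁) + (bit (s₁ v₂) + count s₂)    ≡⟨ cong (λ k → bit (s v₁) + (bit (s₁ v₂) + k)) (count-remove s₂ w) ⟩
    bit (s v₁) + (bit (s₁ v₂) + (bit (s₂ w) + count (remove s₂ w)))
      ≡⟨ cong₂ (λ a b → bit (s v₁) + (bit a + (bit b + count (remove s₂ w))))
           (remove-≢ s (v₁≢v₂ ∘ sym)) (trans (remove-≢ s₁ (v₂≢w ∘ sym)) (remove-≢ s (v₁≢w ∘ sym))) ⟩
    bit (s v₁) + (bit (s v₂) + (bit (s w) + count (remove s₂ w)))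
      ≡⟨ cong (λ k → bit (s v₁) + (bit (s v₂) + (bit (s w) + k))) (¬T⇒count≡0 (remove s₂ w) outside) ⟩
    bit (s v₁) + (bit (s v₂) + (bit (s w) + 0)) ∎
    where
    open ≡-Reasoning
    s₁ = remove s v₁
    s₂ = remove s₁ v₂
    outside : ∀ v → ¬ T (remove s₂ w v)
    outside v t with T-remove⁻ s₂ t
    ... | t₂ , v≢w with T-remove⁻ s₁ t₂
    ...   | t₁ , v≢v₂ with T-remove⁻ s t₁
    ...     | t₀ , v≢v₁ with N-cover v (s⊆N v t₀)
    ...       | inj₁ v≡v₁        = v≢v₁ v≡v₁
    ...       | inj₂ (inj₁ v≡v₂) = v≢v₂ v≡v₂
    ...       | inj₂ (inj₂ v≡w)  = v≢w v≡w

  module _ (S : Subset m) (even : T (evenSubsetᵇ N S)) where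

    evenSubset-w : Vec.lookup S w ≡ Vec.lookup S v₁ xor Vec.lookup S v₂
    evenSubset-w = even-three-bits (Vec.lookup S v₁) (Vec.lookup S v₂) (Vec.lookup S w)
      (subst (λ k → T (k % 2 ≡ᵇ 0)) (trans (∣∣≡count S) (count-star (Vec.lookup S) (evenSubset-⊆ N S even)))
        (proj₂ (Equivalence.to T-∧ even)))

    evenSubset-outside : ∀ v → v ≢ v₁ → v ≢ v₂ → v ≢ w → Vec.lookup S v ≡ false
    evenSubset-outside v v≢v₁ v≢v₂ v≢w with Vec.lookup S v in Sv
    ... | false = refl
    ... | true with N-cover v (evenSubset-⊆ N S even v (subst T (sym Sv) _))
    ...   | inj₁ v≡v₁        = ⊥-elim (v≢v₁ v≡v₁)
    ...   | inj₂ (inj₁ v≡v₂) = ⊥-elim (v≢v₂ v≡v₂)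
    ...   | inj₂ (inj₂ v≡w)  = ⊥-elim (v≢w v≡w)

  evenSubset-ext : ∀ S S′ → T (evenSubsetᵇ N S) → T (evenSubsetᵇ N S′) →
    Vec.lookup S v₁ ≡ Vec.lookup S′ v₁ → Vec.lookup S v₂ ≡ Vec.lookup S′ v₂ → S ≡ S′
  evenSubset-ext S S′ even even′ e₁ e₂ = begin
    S                              ≡⟨ Vecₚ.tabulate∘lookup S ⟨
    Vec.tabulate (Vec.lookup S)    ≡⟨ Vecₚ.tabulate-cong pointwise ⟩
    Vec.tabulate (Vec.lookup S′)   ≡⟨ Vecₚ.tabulate∘lookup S′ ⟩
    S′                             ∎
    where
    open ≡-Reasoning
    pointwise : Vec.lookup S ≗ Vec.lookup S′
    pointwise v with v Fin.≟ v₁ | v Fin.≟ v₂ | v Fin.≟ w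
    ... | yes refl | _        | _        = e₁
    ... | no _     | yes refl | _        = e₂
    ... | no _     | no _     | yes refl =
      trans (evenSubset-w S even) (trans (cong₂ _xor_ e₁ e₂) (sym (evenSubset-w S′ even′)))
    ... | no v≢v₁  | no v≢v₂  | no v≢w   =
      trans (evenSubset-outside S even v v≢v₁ v≢v₂ v≢w) (sym (evenSubset-outside S′ even′ v v≢v₁ v≢v₂ v≢w))

-- The two local matchings of a gadget

-- The four outer vertices of a gadget that a matching in μ(F,f) pairs with its inner vertices,
-- and the encodings of the inner vertices; Fits t e is adjacency (see FreeEnds.fits).
data Free : Set where
  free₁ free₂ free₌ free≠ : Free

Bits : Set
Bits = Bool × Bool

Fits : Free → Bits → Set
Fits free₁ (a , _) = T a
Fits free₂ (_ , b) = T b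
Fits free₌ (a , b) = a xor b ≡ false
Fits free≠ (a , b) = a xor b ≡ true

localMatching : Bool → Free → Bits
localMatching true  free₁ = true  , true
localMatching true  free₂ = false , true
localMatching true  free₌ = false , false
localMatching true  free≠ = true  , false
localMatching false free₁ = true  , false
localMatching false free₂ = true  , true
localMatching false free₌ = false , false
localMatching false free≠ = false , true

localMatching⁻¹ : Bool → Bits → Free
localMatching⁻¹ true  (true  , true)  = free₁
localMatching⁻¹ true  (false , true)  = free₂
localMatching⁻¹ true  (false , false) = free₌
localMatching⁻¹ true  (true  , false) = free≠
localMatching⁻¹ false (true  , false) = free₁
localMatching⁻¹ false (true  , true)  = free₂
localMatching⁻¹ false (false , false) = free₌
localMatching⁻¹ false (false , true)  = free≠

localMatching⁻¹-inverse : ∀ z t → localMatching⁻¹ z (localMatching z t) ≡ t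
localMatching⁻¹-inverse true  free₁ = refl
localMatching⁻¹-inverse true  free₂ = refl
localMatching⁻¹-inverse true  free₌ = refl
localMatching⁻¹-inverse true  free≠ = refl
localMatching⁻¹-inverse false free₁ = refl
localMatching⁻¹-inverse false free₂ = refl
localMatching⁻¹-inverse false free₌ = refl
localMatching⁻¹-inverse false free≠ = refl

localMatching-injective : ∀ z {t t′} → localMatching z t ≡ localMatching z t′ → t ≡ t′
localMatching-injective z {t} {t′} e =
  trans (sym (localMatching⁻¹-inverse z t)) (trans (cong (localMatching⁻¹ z) e) (localMatching⁻¹-inverse z t′))

-- free₌ is the only free vertex that fits (false , false); the remaining fitting pairs form a
-- 6-cycle, whose two perfect matchings are the two local matchings.
local-matching-values : (a b c d : Bits) → Fits free₁ a → Fits free₂ b → Fits free₌ c → Fits free≠ d →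
  a ≢ b → a ≢ c → a ≢ d → b ≢ c → b ≢ d → c ≢ d →
  Σ Bool λ z → a ≡ localMatching z free₁ × b ≡ localMatching z free₂ ×
               c ≡ localMatching z free₌ × d ≡ localMatching z free≠
local-matching-values (true , true)  (false , true) (false , false) (true , false) _ _ _ _ _ _ _ _ _ _ = true  , refl , refl , refl , refl
local-matching-values (true , false) (true , true)  (false , false) (false , true) _ _ _ _ _ _ _ _ _ _ = false , refl , refl , refl , refl
local-matching-values (true , true)  (true , true)  _ _ _ _ _ _ a≢b _ _ _ _ _ = ⊥-elim (a≢b refl)
local-matching-values (true , true)  (false , true) (true , true) _ _ _ _ _ _ a≢c _ _ _ _ = ⊥-elim (a≢c refl)
local-matching-values (true , true)  (false , true) (false , false) (false , true) _ _ _ _ _ _ _ _ b≢d _ = ⊥-elim (b≢d refl)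
local-matching-values (true , false) (true , true)  (true , true) _ _ _ _ _ _ _ _ b≢c _ _ = ⊥-elim (b≢c refl)
local-matching-values (true , false) _ _ (true , false) _ _ _ _ _ _ a≢d _ _ _ = ⊥-elim (a≢d refl)
local-matching-values (true , false) (false , true) _ (false , true) _ _ _ _ _ _ _ _ b≢d _ = ⊥-elim (b≢d refl)
local-matching-values (false , _) _ _ _ () _ _ _ _ _ _ _ _ _
local-matching-values _ (_ , false) _ _ _ () _ _ _ _ _ _ _ _
local-matching-values _ _ (true , false) _ _ _ () _ _ _ _ _ _ _
local-matching-values _ _ (false , true) _ _ _ () _ _ _ _ _ _ _
local-matching-values _ _ _ (true , true) _ _ _ () _ _ _ _ _ _
local-matching-values _ _ _ (false , false) _ _ _ () _ _ _ _ _ _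

local-matching-classification : (g : Free → Bits) → (∀ t → Fits t (g t)) → Injective _≡_ _≡_ g →
  Σ Bool λ z → g ≗ localMatching z
local-matching-classification g fits g-inj
  with local-matching-values (g free₁) (g free₂) (g free₌) (g free≠) (fits free₁) (fits free₂) (fits free₌) (fits free≠)
         (distinct λ ()) (distinct λ ()) (distinct λ ()) (distinct λ ()) (distinct λ ()) (distinct λ ())
  where
  distinct : ∀ {t t′} → t ≢ t′ → g t ≢ g t′
  distinct t≢t′ = t≢t′ ∘ g-inj
... | z , e₁ , e₂ , e₌ , e≠ = z , λ { free₁ → e₁ ; free₂ → e₂ ; free₌ → e₌ ; free≠ → e≠ }

-- (localMatching b)⁻¹ ∘ localMatching a is a 3-cycle or the identity.
local-matching-cycle : ∀ a b {t₀ t₁ t₂} → localMatching a t₀ ≡ localMatching b t₁ →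
  localMatching a t₁ ≡ localMatching b t₂ → localMatching a t₂ ≡ localMatching b t₀
local-matching-cycle a b {t₀} {t₁} {t₂} e₀ e₁ = begin
  localMatching a t₂                                       ≡⟨ cong (localMatching a) t₂≡ ⟩
  localMatching a (κ (κ t₀))                               ≡⟨ cycle a b t₀ ⟩
  localMatching b t₀                                       ∎
  where
  open ≡-Reasoning
  κ = localMatching⁻¹ b ∘ localMatching a
  t₁≡ : t₁ ≡ κ t₀
  t₁≡ = trans (sym (localMatching⁻¹-inverse b t₁)) (cong (localMatching⁻¹ b) (sym e₀))
  t₂≡ : t₂ ≡ κ (κ t₀)
  t₂≡ = trans (sym (localMatching⁻¹-inverse b t₂)) (cong (localMatching⁻¹ b) (trans (sym e₁) (cong (localMatching a) t₁≡)))
  cycle : ∀ a b t → localMatching a (localMatching⁻¹ b (localMatching a (localMatching⁻¹ b (localMatching a t))))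
                    ≡ localMatching b t
  cycle true  true  free₁ = refl
  cycle true  true  free₂ = refl
  cycle true  true  free₌ = refl
  cycle true  true  free≠ = refl
  cycle true  false free₁ = refl
  cycle true  false free₂ = refl
  cycle true  false free₌ = refl
  cycle true  false free≠ = refl
  cycle false true  free₁ = refl
  cycle false true  free₂ = refl
  cycle false true  free₌ = refl
  cycle false true  free≠ = refl
  cycle false false free₁ = refl
  cycle false false free₂ = refl
  cycle false false free₌ = refl
  cycle false false free≠ = refl

-- At a vertex with F-neighbours v₁ , v₂ the outer vertices (v₁ , f₁) and (v₂ , f₂) lie on F-edges of
-- every matching in μ(F,f); the free ones are (endpoint t , colour t). An inner vertex S is encoded
-- by where it deviates from f at v₁ and v₂, which determines S by the parity condition.
module FreeEnds {m : ℕ} {N F : Fin m → Bool} (st : Star N F) (fF : (v : Fin m) → T (F v) → Bool) where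
  open Star st
  open EvenSubsets st

  f₁ f₂ : Bool
  f₁ = fF v₁ F-v₁
  f₂ = fF v₂ F-v₂

  endpoint : Free → Fin m
  endpoint free₁ = v₁
  endpoint free₂ = v₂
  endpoint free₌ = w
  endpoint free≠ = w

  colour : Free → Bool
  colour free₁ = not f₁
  colour free₂ = not f₂
  colour free₌ = f₁ xor f₂
  colour free≠ = not (f₁ xor f₂)

  N-endpoint : ∀ t → T (N (endpoint t))
  N-endpoint free₁ = N-v₁
  N-endpoint free₂ = N-v₂
  N-endpoint free₌ = N-w
  N-endpoint free≠ = N-w

  end-injective : ∀ {t t′} → endpoint t ≡ endpoint t′ → colour t ≡ colour t′ → t ≡ t′
  end-injective {free₁} {free₁} _ _ = refl
  end-injective {free₂} {free₂} _ _ = refl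
  end-injective {free₌} {free₌} _ _ = refl
  end-injective {free≠} {free≠} _ _ = refl
  end-injective {free₁} {free₂} e _ = ⊥-elim (v₁≢v₂ e)
  end-injective {free₂} {free₁} e _ = ⊥-elim (v₁≢v₂ (sym e))
  end-injective {free₁} {free₌} e _ = ⊥-elim (v₁≢w e)
  end-injective {free₁} {free≠} e _ = ⊥-elim (v₁≢w e)
  end-injective {free₌} {free₁} e _ = ⊥-elim (v₁≢w (sym e))
  end-injective {free≠} {free₁} e _ = ⊥-elim (v₁≢w (sym e))
  end-injective {free₂} {free₌} e _ = ⊥-elim (v₂≢w e)
  end-injective {free₂} {free≠} e _ = ⊥-elim (v₂≢w e)
  end-injective {free₌} {free₂} e _ = ⊥-elim (v₂≢w (sym e))
  end-injective {free≠} {free₂} e _ = ⊥-elim (v₂≢w (sym e))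
  end-injective {free₌} {free≠} _ c = ⊥-elim (not-¬ refl c)
  end-injective {free≠} {free₌} _ c = ⊥-elim (not-¬ refl (sym c))

  colour≢f : ∀ t (hF : T (F (endpoint t))) → colour t ≢ fF (endpoint t) hF
  colour≢f free₁ hF e = not-¬ (cong (fF v₁) (T-irrelevant hF F-v₁)) (sym e)
  colour≢f free₂ hF e = not-¬ (cong (fF v₂) (T-irrelevant hF F-v₂)) (sym e)
  colour≢f free₌ hF _ = ¬F-w hF
  colour≢f free≠ hF _ = ¬F-w hF

  end-cases : ∀ v b → T (N v) → (Σ (T (F v)) λ hF → b ≡ fF v hF) ⊎ (Σ Free λ t → v ≡ endpoint t × b ≡ colour t)
  end-cases v b Nv with N-cover v Nv
  ... | inj₁ refl with b Boolₚ.≟ f₁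
  ...   | yes b≡f₁ = inj₁ (F-v₁ , b≡f₁)
  ...   | no b≢f₁  = inj₂ (free₁ , refl , ¬-not b≢f₁)
  end-cases v b Nv | inj₂ (inj₁ refl) with b Boolₚ.≟ f₂
  ...   | yes b≡f₂ = inj₁ (F-v₂ , b≡f₂)
  ...   | no b≢f₂  = inj₂ (free₂ , refl , ¬-not b≢f₂)
  end-cases v b Nv | inj₂ (inj₂ refl) with b Boolₚ.≟ f₁ xor f₂
  ...   | yes b≡c = inj₂ (free₌ , refl , b≡c)
  ...   | no b≢c  = inj₂ (free≠ , refl , ¬-not b≢c)

  enc : Subset m → Bits
  enc S = Vec.lookup S v₁ xor f₁ , Vec.lookup S v₂ xor f₂

  enc-injective : ∀ S S′ → T (evenSubsetᵇ N S) → T (evenSubsetᵇ N S′) → enc S ≡ enc S′ → S ≡ S′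
  enc-injective S S′ even even′ e = evenSubset-ext S S′ even even′
    (xor-cancelʳ f₁ _ _ (cong proj₁ e)) (xor-cancelʳ f₂ _ _ (cong proj₂ e))

  enc-xor : ∀ S → T (evenSubsetᵇ N S) → proj₁ (enc S) xor proj₂ (enc S) ≡ Vec.lookup S w xor (f₁ xor f₂)
  enc-xor S even = trans (xor-interchange (Vec.lookup S v₁) f₁ (Vec.lookup S v₂) f₂)
    (cong (_xor (f₁ xor f₂)) (sym (evenSubset-w S even)))

  -- The hypothesis says that the inner vertex S is adjacent to the free outer vertex t.
  fits : ∀ S → T (evenSubsetᵇ N S) → ∀ t → Vec.lookup S (endpoint t) ≡ colour t → Fits t (enc S)
  fits S even free₁ e = subst T (sym (trans (cong (_xor f₁) e) (xor-inverseˡ f₁))) _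
  fits S even free₂ e = subst T (sym (trans (cong (_xor f₂) e) (xor-inverseˡ f₂))) _
  fits S even free₌ e = trans (enc-xor S even) (trans (cong (_xor (f₁ xor f₂)) e) (xor-same (f₁ xor f₂)))
  fits S even free≠ e = trans (enc-xor S even) (trans (cong (_xor (f₁ xor f₂)) e) (xor-inverseˡ (f₁ xor f₂)))

-- Matchings in μ(F,f)

module CFINeighbourhoods {p q : ℕ} (A : Fin p → Fin q → Bool) where
  open CFI A

  xIn-cong : ∀ {u S S′ h h′} → S ≡ S′ → xIn u S h ≡ xIn u S′ h′
  xIn-cong {h = h} {h′} refl = cong (xIn _ _) (T-irrelevant h h′)

  xOut-cong : ∀ {v u u′ h h′ b b′} → u ≡ u′ → b ≡ b′ → xOut v u h b ≡ xOut v u′ h′ b′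
  xOut-cong {h = h} {h′} refl refl = cong (λ h → xOut _ _ h _) (T-irrelevant h h′)

  yIn-cong : ∀ {v S S′ h h′} → S ≡ S′ → yIn v S h ≡ yIn v S′ h′
  yIn-cong {h = h} {h′} refl = cong (yIn _ _) (T-irrelevant h h′)

  yOut-cong : ∀ {u v v′ h h′ b b′} → v ≡ v′ → b ≡ b′ → yOut u v h b ≡ yOut u v′ h′ b′
  yOut-cong {h = h} {h′} refl refl = cong (λ h → yOut _ _ h _) (T-irrelevant h h′)

  xIn≢xOut : ∀ {u S h v u′ h′ b} → xIn u S h ≢ xOut v u′ h′ b
  xIn≢xOut ()

  yIn≢yOut : ∀ {v S h u v′ h′ b} → yIn v S h ≢ yOut u v′ h′ b
  yIn≢yOut ()

  xIn-injective : ∀ {u u′ S S′ h h′} → xIn u S h ≡ xIn u′ S′ h′ → S ≡ S′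
  xIn-injective refl = refl

  yIn-injective : ∀ {v v′ S S′ h h′} → yIn v S h ≡ yIn v′ S′ h′ → S ≡ S′
  yIn-injective refl = refl

  adj-xIn : ∀ {u S h y} → Adj (xIn u S h) y →
    Σ (Fin q) λ v → Σ (T (A u v)) λ h′ → y ≡ yOut u v h′ (Vec.lookup S v)
  adj-xIn (inU-out u S h v h′) = v , h′ , refl

  adj-yIn : ∀ {v S h x} → Adj x (yIn v S h) →
    Σ (Fin p) λ u → Σ (T (A u v)) λ h′ → x ≡ xOut v u h′ (Vec.lookup S u)
  adj-yIn (out-inV v u h S h′) = u , h , refl

  adj-xOut : ∀ {v u h b y} → Adj (xOut v u h b) y →
    (Σ (Subset p) λ S → Σ (T (okInV v S)) λ h′ → y ≡ yIn v S h′ × Vec.lookup S u ≡ b) ⊎ y ≡ yOut u v h b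
  adj-xOut (out-inV v u h S h′)   = inj₁ (S , h′ , refl , refl)
  adj-xOut (out-out v u h h′ b)   = inj₂ (yOut-cong refl refl)

  adj-yOut : ∀ {u v h b x} → Adj x (yOut u v h b) →
    (Σ (Subset q) λ S → Σ (T (okInU u S)) λ h′ → x ≡ xIn u S h′ × Vec.lookup S v ≡ b) ⊎ x ≡ xOut v u h b
  adj-yOut (inU-out u S h v h′) = inj₁ (S , h , refl , refl)
  adj-yOut (out-out v u h h′ b) = inj₂ (xOut-cong refl refl)

module CFIMatchings {p q : ℕ} (A : Fin p → Fin q → Bool)
  (degU : ∀ u → ∣ Vec.tabulate (λ v → A u v) ∣ ≡ 3)
  (degV : ∀ v → ∣ Vec.tabulate (λ u → A u v) ∣ ≡ 3)
  (F : Fin p → Fin q → Bool) (hF : CFI.IsTwoFactor A F)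
  (f : (u : Fin p) (v : Fin q) → T (F u v) → Bool) where
  open CFI A
  open CFINeighbourhoods A

  F⊆A : SubsetE F
  F⊆A = proj₁ hF

  module Matching (μ : Xv → Yv) (hμ : InMuFf F F⊆A f μ) where
    private
      perfect = proj₁ hμ
      uniform = proj₁ (proj₂ hμ)
      exactlyOne = proj₁ (proj₂ (proj₂ hμ))
      usesF = proj₂ (proj₂ (proj₂ hμ))

    μ-injective : Injective _≡_ _≡_ μ
    μ-injective = proj₁ (proj₁ perfect)

    μ-adj : ∀ x → Adj x (μ x)
    μ-adj = proj₂ perfect

    ν : Yv → Xv
    ν y = proj₁ (proj₂ (proj₁ perfect) y)

    μν : ∀ y → μ (ν y) ≡ y
    μν y = proj₂ (proj₂ (proj₁ perfect) y) refl

    νμ : ∀ x → ν (μ x) ≡ x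
    νμ x = μ-injective (μν (μ x))

    ν-adj : ∀ y → Adj (ν y) y
    ν-adj y = subst (Adj (ν y)) (μν y) (μ-adj (ν y))

    F-edge : ∀ u v h (hF : T (F u v)) → EdgeIn μ u v h (f u v hF)
    F-edge u v h hF = subst (λ h → EdgeIn μ u v h (f u v hF)) (T-irrelevant (F⊆A u v hF) h) (usesF u v hF)

    edge⇒F : ∀ u v h b → EdgeIn μ u v h b → Σ (T (F u v)) λ hF → b ≡ f u v hF
    edge⇒F u v h b e = hF′ , same-colour b (f u v hF′) e (F-edge u v h hF′)
      where
      one : ∀ b → EdgeIn μ u v h b → ExactlyOne (EdgeIn μ u v h false) (EdgeIn μ u v h true)
      one false e = inj₁ (e , λ e′ → uniform u v h (e , e′))
      one true  e = inj₂ ((λ e′ → uniform u v h (e′ , e)) , e)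
      hF′ = proj₂ (exactlyOne u v h) (one b e)
      same-colour : ∀ b c → EdgeIn μ u v h b → EdgeIn μ u v h c → b ≡ c
      same-colour false false _ _ = refl
      same-colour true  true  _ _ = refl
      same-colour false true  e e′ = ⊥-elim (uniform u v h (e , e′))
      same-colour true  false e e′ = ⊥-elim (uniform u v h (e′ , e))

  module AtU (u : Fin p) where
    st : Star (A u) (F u)
    st = star (A u) (F u) (trans (sym (∣tabulate∣≡count (A u))) (degU u))
      (trans (sym (∣tabulate∣≡count (F u))) (proj₁ (proj₂ hF) u)) (F⊆A u)
    open Star st
    open FreeEnds st (f u) public

    tokY : Free → Yv
    tokY t = yOut u (endpoint t) (N-endpoint t) (colour t)

    tokY-injective : Injective _≡_ _≡_ tokY
    tokY-injective {t} {t′} e = end-injective (ends e) (colours e)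
      where
      ends : ∀ {v v′ h h′ b b′} → yOut u v h b ≡ yOut u v′ h′ b′ → v ≡ v′
      ends refl = refl
      colours : ∀ {v v′ h h′ b b′} → yOut u v h b ≡ yOut u v′ h′ b′ → b ≡ b′
      colours refl = refl

    module Local (μ : Xv → Yv) (hμ : InMuFf F F⊆A f μ) where
      open Matching μ hμ

      token : ∀ S h → Σ Free λ t → μ (xIn u S h) ≡ tokY t
      token S h with adj-xIn (μ-adj (xIn u S h))
      ... | v , h′ , μx≡ with end-cases v (Vec.lookup S v) h′
      ...   | inj₁ (hF , b≡f) =
        ⊥-elim (xIn≢xOut (μ-injective (trans μx≡ (trans (yOut-cong refl b≡f) (sym (F-edge u v h′ hF))))))
      ...   | inj₂ (t , refl , b≡c) = t , trans μx≡ (yOut-cong refl b≡c)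

      partner : ∀ t → Σ (Subset q) λ S → Σ (T (okInU u S)) λ h → ν (tokY t) ≡ xIn u S h × Fits t (enc S)
      partner t with adj-yOut (ν-adj (tokY t))
      ... | inj₁ (S , h , νy≡ , S-end≡c) = S , h , νy≡ , fits S h t S-end≡c
      ... | inj₂ νy≡ = ⊥-elim (colour≢f t (proj₁ F-end) (proj₂ F-end))
        where
        F-end = edge⇒F u (endpoint t) (N-endpoint t) (colour t) (trans (cong μ (sym νy≡)) (μν (tokY t)))

      localEnc : Free → Bits
      localEnc t = enc (proj₁ (partner t))

      localEnc-injective : Injective _≡_ _≡_ localEnc
      localEnc-injective {t} {t′} e = tokY-injective (begin
        tokY t            ≡⟨ μν (tokY t) ⟨
        μ (ν (tokY t))    ≡⟨ cong μ (trans ν≡ (trans (xIn-cong S≡S′) (sym ν≡′))) ⟩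
        μ (ν (tokY t′))   ≡⟨ μν (tokY t′) ⟩
        tokY t′           ∎)
        where
        open ≡-Reasoning
        open Σ (partner t) renaming (proj₁ to S; proj₂ to rest)
        open Σ (partner t′) renaming (proj₁ to S′; proj₂ to rest′)
        ν≡ = proj₁ (proj₂ rest)
        ν≡′ = proj₁ (proj₂ rest′)
        S≡S′ = enc-injective S S′ (proj₁ rest) (proj₁ rest′) e

      classification : Σ Bool λ z → localEnc ≗ localMatching z
      classification = local-matching-classification localEnc (λ t → proj₂ (proj₂ (proj₂ (partner t)))) localEnc-injective

      z : Bool
      z = proj₁ classification

      enc-token : ∀ S h t → μ (xIn u S h) ≡ tokY t → enc S ≡ localMatching z t
      enc-token S h t μx≡ = trans (cong enc (xIn-injective (trans (sym (νμ _)) (trans (cong ν μx≡) ν≡))))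
                              (proj₂ classification t)
        where ν≡ = proj₁ (proj₂ (proj₂ (partner t)))

  module AtV (v : Fin q) where
    st : Star (λ u → A u v) (λ u → F u v)
    st = star (λ u → A u v) (λ u → F u v) (trans (sym (∣tabulate∣≡count (λ u → A u v))) (degV v))
      (trans (sym (∣tabulate∣≡count (λ u → F u v))) (proj₂ (proj₂ hF) v)) (λ u → F⊆A u v)
    open Star st
    open FreeEnds st (λ u → f u v) public

    tokX : Free → Xv
    tokX t = xOut v (endpoint t) (N-endpoint t) (colour t)

    tokX-injective : Injective _≡_ _≡_ tokX
    tokX-injective {t} {t′} e = end-injective (ends e) (colours e)
      where
      ends : ∀ {u u′ h h′ b b′} → xOut v u h b ≡ xOut v u′ h′ b′ → u ≡ u′
      ends refl = refl
      colours : ∀ {u u′ h h′ b b′} → xOut v u h b ≡ xOut v u′ h′ b′ → b ≡ b′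
      colours refl = refl

    module Local (μ : Xv → Yv) (hμ : InMuFf F F⊆A f μ) where
      open Matching μ hμ

      free-token : ∀ u h b → ¬ EdgeIn μ u v h b → Σ Free λ t → xOut v u h b ≡ tokX t
      free-token u h b ¬edge with end-cases u b h
      ... | inj₁ (hF , b≡f) = ⊥-elim (¬edge (subst (EdgeIn μ u v h) (sym b≡f) (F-edge u v h hF)))
      ... | inj₂ (t , refl , b≡c) = t , xOut-cong refl b≡c

      partner : ∀ t → Σ (Subset p) λ S → Σ (T (okInV v S)) λ h → μ (tokX t) ≡ yIn v S h × Fits t (enc S)
      partner t with adj-xOut (μ-adj (tokX t))
      ... | inj₁ (S , h , μx≡ , S-end≡c) = S , h , μx≡ , fits S h t S-end≡c
      ... | inj₂ μx≡ = ⊥-elim (colour≢f t (proj₁ F-end) (proj₂ F-end))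
        where
        F-end = edge⇒F (endpoint t) v (N-endpoint t) (colour t) μx≡

      localEnc : Free → Bits
      localEnc t = enc (proj₁ (partner t))

      localEnc-injective : Injective _≡_ _≡_ localEnc
      localEnc-injective {t} {t′} e = tokX-injective (μ-injective (trans μx≡ (trans (yIn-cong S≡S′) (sym μx≡′))))
        where
        open Σ (partner t) renaming (proj₁ to S; proj₂ to rest)
        open Σ (partner t′) renaming (proj₁ to S′; proj₂ to rest′)
        μx≡ = proj₁ (proj₂ rest)
        μx≡′ = proj₁ (proj₂ rest′)
        S≡S′ = enc-injective S S′ (proj₁ rest) (proj₁ rest′) e

      classification : Σ Bool λ z → localEnc ≗ localMatching z
      classification = local-matching-classification localEnc (λ t → proj₂ (proj₂ (proj₂ (partner t)))) localEnc-injective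

      z : Bool
      z = proj₁ classification

      enc-token : ∀ S h t → μ (tokX t) ≡ yIn v S h → enc S ≡ localMatching z t
      enc-token S h t μx≡ = trans (cong enc (yIn-injective (trans (sym μx≡) μx≡′))) (proj₂ classification t)
        where μx≡′ = proj₁ (proj₂ (proj₂ (partner t)))

  module Rotation (μ₁ : Xv → Yv) (hμ₁ : InMuFf F F⊆A f μ₁) (μ₂ : Xv → Yv) (hμ₂ : InMuFf F F⊆A f μ₂) where
    module M₁ = Matching μ₁ hμ₁
    module M₂ = Matching μ₂ hμ₂

    ρ : Xv → Xv
    ρ = M₁.ν ∘ μ₂

    μ₁∘ρ≗μ₂ : μ₁ ∘ ρ ≗ μ₂
    μ₁∘ρ≗μ₂ x = M₁.μν (μ₂ x)

    module _ (u : Fin p) where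
      open AtU u
      module U₁ = Local μ₁ hμ₁
      module U₂ = Local μ₂ hμ₂

      token₂ : ∀ S h → Free
      token₂ S h = proj₁ (U₂.token S h)

      next : ∀ S h → Subset q
      next S h = proj₁ (U₁.partner (token₂ S h))

      next-inner : ∀ S h → T (okInU u (next S h))
      next-inner S h = proj₁ (proj₂ (U₁.partner (token₂ S h)))

      ρ-inner : ∀ S h → ρ (xIn u S h) ≡ xIn u (next S h) (next-inner S h)
      ρ-inner S h = trans (cong M₁.ν (proj₂ (U₂.token S h))) (proj₁ (proj₂ (proj₂ (U₁.partner (token₂ S h)))))

      enc-inner : ∀ S h → enc S ≡ localMatching U₂.z (token₂ S h)
      enc-inner S h = U₂.enc-token S h (token₂ S h) (proj₂ (U₂.token S h))

      enc-next : ∀ S h → enc (next S h) ≡ localMatching U₁.z (token₂ S h)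
      enc-next S h = proj₂ U₁.classification (token₂ S h)

      ρ³-inner : ∀ S h → ρ (ρ (ρ (xIn u S h))) ≡ xIn u S h
      ρ³-inner S₀ h₀ = begin
        ρ (ρ (ρ (xIn u S₀ h₀)))  ≡⟨ cong (ρ ∘ ρ) (ρ-inner S₀ h₀) ⟩
        ρ (ρ (xIn u S₁ h₁))      ≡⟨ cong ρ (ρ-inner S₁ h₁) ⟩
        ρ (xIn u S₂ h₂)          ≡⟨ ρ-inner S₂ h₂ ⟩
        xIn u S₃ h₃              ≡⟨ xIn-cong (enc-injective S₃ S₀ h₃ h₀ enc₃≡enc₀) ⟩
        xIn u S₀ h₀              ∎
        where
        open ≡-Reasoning
        S₁ = next S₀ h₀
        h₁ = next-inner S₀ h₀
        S₂ = next S₁ h₁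
        h₂ = next-inner S₁ h₁
        S₃ = next S₂ h₂
        h₃ = next-inner S₂ h₂
        enc₃≡enc₀ : enc S₃ ≡ enc S₀
        enc₃≡enc₀ = trans (enc-next S₂ h₂) (trans (local-matching-cycle U₁.z U₂.z
          (trans (sym (enc-next S₀ h₀)) (enc-inner S₁ h₁)) (trans (sym (enc-next S₁ h₁)) (enc-inner S₂ h₂)))
          (sym (enc-inner S₀ h₀)))

    module _ (v : Fin q) where
      open AtV v
      module V₁ = Local μ₁ hμ₁
      module V₂ = Local μ₂ hμ₂

      ρ-token : ∀ t → Σ Free λ t′ → ρ (tokX t) ≡ tokX t′ × localMatching V₂.z t ≡ localMatching V₁.z t′
      ρ-token t = t′ , trans (cong M₁.ν μ₂x≡) (trans ν≡ x≡) ,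
                  trans (sym (proj₂ V₂.classification t)) (V₁.enc-token S h t′ (trans (cong μ₁ (sym x≡)) μ₁x≡))
        where
        S = proj₁ (V₂.partner t)
        h = proj₁ (proj₂ (V₂.partner t))
        μ₂x≡ = proj₁ (proj₂ (proj₂ (V₂.partner t)))
        end = adj-yIn (M₁.ν-adj (yIn v S h))
        u = proj₁ end
        h′ = proj₁ (proj₂ end)
        ν≡ = proj₂ (proj₂ end)
        μ₁x≡ : μ₁ (xOut v u h′ (Vec.lookup S u)) ≡ yIn v S h
        μ₁x≡ = trans (cong μ₁ (sym ν≡)) (M₁.μν (yIn v S h))
        free = V₁.free-token u h′ (Vec.lookup S u) λ edge → yIn≢yOut (trans (sym μ₁x≡) edge)
        t′ = proj₁ free
        x≡ = proj₂ free

      ρ³-token : ∀ t → ρ (ρ (ρ (tokX t))) ≡ tokX t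
      ρ³-token t₀ = begin
        ρ (ρ (ρ (tokX t₀)))  ≡⟨ cong (ρ ∘ ρ) (proj₁ (proj₂ (ρ-token t₀))) ⟩
        ρ (ρ (tokX t₁))      ≡⟨ cong ρ (proj₁ (proj₂ (ρ-token t₁))) ⟩
        ρ (tokX t₂)          ≡⟨ proj₁ (proj₂ (ρ-token t₂)) ⟩
        tokX t₃              ≡⟨ cong tokX (localMatching-injective V₁.z
                                  (trans (sym (step t₂)) (local-matching-cycle V₂.z V₁.z (step t₀) (step t₁)))) ⟩
        tokX t₀              ∎
        where
        open ≡-Reasoning
        step : ∀ t → localMatching V₂.z t ≡ localMatching V₁.z (proj₁ (ρ-token t))
        step t = proj₂ (proj₂ (ρ-token t))
        t₁ = proj₁ (ρ-token t₀)
        t₂ = proj₁ (ρ-token t₁)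
        t₃ = proj₁ (ρ-token t₂)

    ρ³≗id : ρ ∘ ρ ∘ ρ ≗ id
    ρ³≗id (xIn u S h) = ρ³-inner u S h
    ρ³≗id (xOut v u h b) with adj-xOut (M₂.μ-adj (xOut v u h b))
    ... | inj₁ (S , h′ , μ₂x≡ , _) = subst (λ x → ρ (ρ (ρ x)) ≡ x) (sym (proj₂ free)) (ρ³-token v (proj₁ free))
      where
      free = AtV.Local.free-token v μ₂ hμ₂ u h b λ edge → yIn≢yOut (trans (sym μ₂x≡) edge)
    ... | inj₂ edge = trans (cong (ρ ∘ ρ) ρx≡x) (trans (cong ρ ρx≡x) ρx≡x)
      where
      F-end = M₂.edge⇒F u v h b edge
      edge₁ : EdgeIn μ₁ u v h b
      edge₁ = subst (EdgeIn μ₁ u v h) (sym (proj₂ F-end)) (M₁.F-edge u v h (proj₁ F-end))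
      ρx≡x : ρ (xOut v u h b) ≡ xOut v u h b
      ρx≡x = begin
        M₁.ν (μ₂ (xOut v u h b))   ≡⟨ cong M₁.ν (trans edge (sym edge₁)) ⟩
        M₁.ν (μ₁ (xOut v u h b))   ≡⟨ M₁.νμ _ ⟩
        xOut v u h b               ∎
        where open ≡-Reasoning

mainTheorem4 : {p q : ℕ} (A : Fin p → Fin q → Bool) →
    (∀ u → ∣ tabulate (λ v → A u v) ∣ ≡ 3) →
    (∀ v → ∣ tabulate (λ u → A u v) ∣ ≡ 3) →
    (n : ℕ) (η : CFI.Xv A ↔ Fin n) (η' : CFI.Yv A ↔ Fin n) →
    (F : Fin p → Fin q → Bool) (hF : CFI.IsTwoFactor A F) →
    (f : (u : Fin p) (v : Fin q) → T (F u v) → Bool) →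
    (μ₁ μ₂ : CFI.Xv A → CFI.Yv A) →
    CFI.InMuFf A F (proj₁ hF) f μ₁ →
    CFI.InMuFf A F (proj₁ hF) f μ₂ →
    CFI.sgnPM A η η' μ₁ ≡ CFI.sgnPM A η η' μ₂
mainTheorem4 A degU degV n η η′ F hF f μ₁ μ₂ hμ₁ hμ₂ =
  sgnPerm-conj-order3 η η′ μ₁ μ₂ ρ M₁.μ-injective ρ³≗id μ₁∘ρ≗μ₂
  where open CFIMatchings.Rotation A degU degV F hF f μ₁ hμ₁ μ₂ hμ₂
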